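{- Let $G$ be a finite oriented graph with a vertex $v_0$ of minimum out-degree, and assume every vertex of $G$ satisfies the Decreasing Neighborhood Sequence Property and that $G$ has no back arcs. Then every vertex $x$ in the rooted neighborhood $R_1$ satisfies $|\mathrm{int}(v_0,x)|\ge 1$.
   Context: An oriented graph is a directed graph with no loops and at most one arc between any two vertices. $N^+(v)=\{w: v\to w\}$ and $N^{++}(v)=\{w: \exists x,\ v\to x\to w,\ w\notin N^+(v)\}$. A vertex $u$ has the Decreasing Neighborhood Sequence Property (DNSP) if $|N^{++}(u)|<|N^+(u)|$. $R_i$ is the set of vertices at directed distance exactly $i$ from $v_0$ (so $R_1=N^+(v_0)$). A back arc is an arc from a vertex of $R_i$ to a vertex of $R_j$ with $j<i$. $\mathrm{int}(u,v)=N^+(u)\cap N^+(v)$. -}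

module Defs where

open import Data.Nat using (ℕ; zero; suc; _<_)
open import Data.Bool using (Bool; true; false; _∧_; _∨_; not; T)
open import Data.Fin using (Fin; _≟_)
open import Data.List using (List; length; filter)
open import Data.Bool.ListAction using (any)
open import Data.List.Base using (allFin)
open import Data.Empty using (⊥)
open import Relation.Binary.PropositionalEquality using (_≡_)
open import Relation.Nullary.Decidable using (T?; does)

record OrientedGraph (n : ℕ) : Set where
  field
    arc     : Fin n → Fin n → Bool
    noLoop  : ∀ v → arc v v ≡ false
    oriented : ∀ u v → arc u v ≡ true → arc v u ≡ false

count : {n : ℕ} → (Fin n → Bool) → ℕ
count {n} p = length (filter (λ x → T? (p x)) (allFin n))

module _ {n : ℕ} (G : OrientedGraph n) where
  open OrientedGraph G

  N⁺ : Fin n → Fin n → Bool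
  N⁺ v w = arc v w

  N⁺⁺ : Fin n → Fin n → Bool
  N⁺⁺ v w = any (λ x → arc v x ∧ arc x w) (allFin n) ∧ not (arc v w)

  DNSP : Fin n → Set
  DNSP u = count (N⁺⁺ u) < count (N⁺ u)

  within : ℕ → Fin n → Fin n → Bool
  within zero    v w = does (v ≟ w)
  within (suc k) v w = within k v w ∨ any (λ x → within k v x ∧ arc x w) (allFin n)

  R : ℕ → Fin n → Fin n → Bool
  R zero    v w = within zero v w
  R (suc i) v w = within (suc i) v w ∧ not (within i v w)

  NoBackArcs : Fin n → Set
  NoBackArcs v₀ = ∀ i j u w → R i v₀ u ≡ true → R j v₀ w ≡ true → j < i →
                  arc u w ≡ true → ⊥

  int : Fin n → Fin n → Fin n → Bool
  int u v w = N⁺ u w ∧ N⁺ v w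

  outdeg : Fin n → ℕ
  outdeg v = count (N⁺ v)

{-# OPTIONS --safe #-}
module Submission where

open import Defs
open import Data.Nat using (ℕ; _≤_; _+_; z≤n; s≤s)
open import Data.Nat.Properties
  using (≤-trans; ≤-reflexive; n≤1+n; +-suc; +-identityʳ; +-monoʳ-≤; +-cancelˡ-<; module ≤-Reasoning)
open import Data.Fin using (Fin; _≟_)
open import Data.Bool using (Bool; true; false; _∧_; _∨_; T)
open import Data.Bool.ListAction using (any)
open import Data.Bool.Properties using (T-≡; T-∧; T-∨)
open import Data.List using (List; []; _∷_; length; filter; allFin)
open import Data.List.Relation.Unary.Any using (satisfied)
open import Data.List.Relation.Unary.Any.Properties using (any⁺; any⁻)
open import Data.List.Membership.Propositional using (lose)
open import Data.List.Membership.Propositional.Properties using (∈-allFin)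
open import Data.List.Relation.Binary.Sublist.Propositional using (⊆-refl)
open import Data.List.Relation.Binary.Sublist.Propositional.Properties using (filter⁺; length-mono-≤)
open import Data.Product using (_,_; proj₁)
open import Data.Sum using (inj₁; inj₂)
open import Function using (_∘_; Equivalence)
open import Relation.Binary.PropositionalEquality using (_≡_; refl; sym)
open import Relation.Nullary.Decidable using (T?; yes; no)

-- Every out-neighbour w of x ∈ N⁺(v₀) lies in N⁺⁺(v₀) (if v₀ ↛ w) or in int(v₀,x)
-- (if v₀ → w).  Hence, by minimality of v₀'s out-degree,
--   |N⁺(v₀)| ≤ |N⁺(x)| ≤ |N⁺⁺(v₀)| + |int(v₀,x)|,
-- and DNSP at v₀, |N⁺⁺(v₀)| < |N⁺(v₀)|, leaves no room for int(v₀,x) = ∅.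

countIn : {A : Set} → (A → Bool) → List A → ℕ
countIn p xs = length (filter (λ x → T? (p x)) xs)

module _ {A : Set} {p q : A → Bool} where

  countIn-mono : (∀ x → T (p x) → T (q x)) → ∀ xs → countIn p xs ≤ countIn q xs
  countIn-mono p⇒q xs =
    length-mono-≤ (filter⁺ (T? ∘ p) (T? ∘ q) (λ { refl → p⇒q _ }) (⊆-refl {x = xs}))

  countIn-∨ : ∀ xs → countIn (λ x → p x ∨ q x) xs ≤ countIn p xs + countIn q xs
  countIn-∨ [] = z≤n
  countIn-∨ (x ∷ xs) with p x | q x | countIn-∨ xs
  ... | true  | true  | ih = s≤s (≤-trans ih (+-monoʳ-≤ (countIn p xs) (n≤1+n _)))
  ... | true  | false | ih = s≤s ih
  ... | false | true  | ih = ≤-trans (s≤s ih) (≤-reflexive (sym (+-suc (countIn p xs) _)))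
  ... | false | false | ih = ih

module _ {n : ℕ} (G : OrientedGraph n) where
  open OrientedGraph G using (arc)

  R₁⇒arc : ∀ {v x} → T (R G 1 v x) → T (arc v x)
  R₁⇒arc {v} {x} v↝x with v ≟ x
  ... | yes refl with () ← v↝x
  ... | no _ with satisfied (any⁻ _ (allFin n) (proj₁ (Equivalence.to T-∧ v↝x)))
  ...   | y , v≡y∧y→x with v ≟ y
  ...     | yes refl = v≡y∧y→x
  ...     | no _ with () ← v≡y∧y→x

  arc⇒N⁺⊆N⁺⁺∪int : ∀ {v x} → T (arc v x) →
                    ∀ w → T (N⁺ G x w) → T (N⁺⁺ G v w ∨ int G v x w)
  arc⇒N⁺⊆N⁺⁺∪int {v} {x} v→x w x→w with arc v w
  ... | true  = Equivalence.from T-∨ (inj₂ x→w)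
  ... | false = Equivalence.from T-∨ (inj₁ (Equivalence.from T-∧ (v⇉w , _)))
    where
    v⇉w : T (any (λ y → arc v y ∧ arc y w) (allFin n))
    v⇉w = any⁺ _ (lose (∈-allFin x) (Equivalence.from T-∧ (v→x , x→w)))

  arc⇒outdeg≤N⁺⁺+int : ∀ {v x} → T (arc v x) → outdeg G x ≤ count (N⁺⁺ G v) + count (int G v x)
  arc⇒outdeg≤N⁺⁺+int v→x =
    ≤-trans (countIn-mono (arc⇒N⁺⊆N⁺⁺∪int v→x) (allFin n)) (countIn-∨ (allFin n))

lemma9 : (n : ℕ) (G : OrientedGraph n) (v₀ : Fin n) →
         (∀ v → outdeg G v₀ ≤ outdeg G v) →
         (∀ u → DNSP G u) →
         NoBackArcs G v₀ →
         ∀ x → R G 1 v₀ x ≡ true → 1 ≤ count (int G v₀ x)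
lemma9 n G v₀ v₀-min dnsp _ x v₀↝x = +-cancelˡ-< (count (N⁺⁺ G v₀)) 0 _ (begin-strict
  count (N⁺⁺ G v₀) + 0                     ≡⟨ +-identityʳ _ ⟩
  count (N⁺⁺ G v₀)                         <⟨ dnsp v₀ ⟩
  outdeg G v₀                              ≤⟨ v₀-min x ⟩
  outdeg G x                               ≤⟨ arc⇒outdeg≤N⁺⁺+int G (R₁⇒arc G (Equivalence.from T-≡ v₀↝x)) ⟩
  count (N⁺⁺ G v₀) + count (int G v₀ x)    ∎)
  where open ≤-Reasoning
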